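{- Let $L$ be a geometric lattice of rank $r+1$ with a fixed linear order on its atoms. Let $(b_1,\dots,b_i,b_{i+1},\dots,b_{r+1})$ be the minimal labeling of a facet of $\Delta(L)$. If $b_i<b_{i+1}$, then $(b_1,\dots,b_{i+1},b_i,\dots,b_{r+1})$ (the sequence with the entries in positions $i$ and $i+1$ swapped) is also the minimal labeling of a facet of $\Delta(L)$.
   Context: A geometric lattice is a finite graded atomic lattice whose rank function $\rho$ satisfies $\rho(x\vee y)+\rho(x\wedge y)\le\rho(x)+\rho(y)$. $\Delta(L)$ is the order complex of $L$; its facets correspond to maximal chains $\hat0=x_0<x_1<\dots<x_{r+1}=\hat1$. The minimal labeling of such a facet is $(\lambda(x_0,x_1),\dots,\lambda(x_r,x_{r+1}))$, where $\lambda(x,y)$ is the least atom $e$ with $x\vee e=y$. A sequence of atoms $(c_1,\dots,c_{r+1})$ "is the minimal labeling of a facet" means that for the chain $y_k=c_1\vee\dots\vee c_k$ one has $\hat0<y_1<\dots<y_{r+1}=\hat1$ saturated and $c_k=\lambda(y_{k-1},y_k)$ for all $k$. -}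

module Defs where

open import Level using (Level; _⊔_)
open import Data.Nat using (ℕ; zero; suc; _+_) renaming (_≤_ to _≤ℕ_)
open import Data.Unit.Polymorphic using () renaming (⊤ to ⊤ᵤ)
open import Data.List using (List; []; _∷_; foldr; length)
open import Data.List.Relation.Unary.All using (All)
open import Data.List.Relation.Unary.Any using (Any)
open import Data.Product using (Σ; ∃; _×_)
open import Data.Sum using (_⊎_)
open import Relation.Nullary using (¬_)
open import Relation.Binary using (Rel; Tri)
open import Relation.Binary.PropositionalEquality using (_≡_)
open import Relation.Binary.Lattice.Bundles using (BoundedLattice)

module LatticeNotions {c ℓ₁ ℓ₂ : Level} (L : BoundedLattice c ℓ₁ ℓ₂) where
  open BoundedLattice L

  _<_ : Rel Carrier (ℓ₁ ⊔ ℓ₂)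
  x < y = x ≤ y × ¬ (x ≈ y)

  _⋖_ : Rel Carrier (c ⊔ ℓ₁ ⊔ ℓ₂)
  x ⋖ y = x < y × (∀ z → x ≤ z → z ≤ y → (z ≈ x) ⊎ (z ≈ y))

  IsAtom : Carrier → Set (c ⊔ ℓ₁ ⊔ ℓ₂)
  IsAtom a = ⊥ ⋖ a

  ⋁ : List Carrier → Carrier
  ⋁ = foldr _∨_ ⊥

  IsFinite : Set (c ⊔ ℓ₁)
  IsFinite = Σ (List Carrier) λ xs → ∀ x → Any (x ≈_) xs

  IsAtomic : Set (c ⊔ ℓ₁ ⊔ ℓ₂)
  IsAtomic = ∀ x → Σ (List Carrier) λ as → All IsAtom as × (x ≈ ⋁ as)

  IsRankFunction : (Carrier → ℕ) → Set (c ⊔ ℓ₁ ⊔ ℓ₂)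
  IsRankFunction ρ =
    (ρ ⊥ ≡ 0) × (∀ {x y} → x ≈ y → ρ x ≡ ρ y) × (∀ {x y} → x ⋖ y → ρ y ≡ suc (ρ x))

  IsSemimodularRank : (Carrier → ℕ) → Set c
  IsSemimodularRank ρ = ∀ x y → ρ (x ∨ y) + ρ (x ∧ y) ≤ℕ ρ x + ρ y

  IsGeometricOfRank : ℕ → (Carrier → ℕ) → Set (c ⊔ ℓ₁ ⊔ ℓ₂)
  IsGeometricOfRank n ρ =
    IsFinite × IsAtomic × IsRankFunction ρ × IsSemimodularRank ρ × (ρ ⊤ ≡ n)

  IsLinearOrderOnAtoms : ∀ {ℓ} → Rel Carrier ℓ → Set (c ⊔ ℓ₁ ⊔ ℓ₂ ⊔ ℓ)
  IsLinearOrderOnAtoms _⊏_ =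
    (∀ {a b a' b'} → a ≈ a' → b ≈ b' → a ⊏ b → a' ⊏ b')
    × (∀ {a b d} → IsAtom a → IsAtom b → IsAtom d → a ⊏ b → b ⊏ d → a ⊏ d)
    × (∀ a b → IsAtom a → IsAtom b → Tri (a ⊏ b) (a ≈ b) (b ⊏ a))

  module _ {ℓ} (_⊏_ : Rel Carrier ℓ) where
    IsMinLabel : Carrier → Carrier → Carrier → Set (c ⊔ ℓ₁ ⊔ ℓ₂ ⊔ ℓ)
    IsMinLabel x y e =
      IsAtom e × (x ∨ e ≈ y)
      × (∀ e' → IsAtom e' → x ∨ e' ≈ y → (e ≈ e') ⊎ (e ⊏ e'))

    -- starting at x, the sequence cs builds a saturated chain
    -- x = y₀ ⋖ y₁ ⋖ … ⋖ y_m = 1̂ with y_k = y_{k-1} ∨ c_k and c_k = λ(y_{k-1}, y_k)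
    MinLabFrom : Carrier → List Carrier → Set (c ⊔ ℓ₁ ⊔ ℓ₂ ⊔ ℓ)
    MinLabFrom x [] = (x ≈ ⊤) × ⊤ᵤ {c ⊔ ℓ₂ ⊔ ℓ}
    MinLabFrom x (e ∷ cs) = (x ⋖ (x ∨ e)) × IsMinLabel x (x ∨ e) e × MinLabFrom (x ∨ e) cs

    IsMinLabelingOfFacet : ℕ → List Carrier → Set (c ⊔ ℓ₁ ⊔ ℓ₂ ⊔ ℓ)
    IsMinLabelingOfFacet r cs = (length cs ≡ suc r) × MinLabFrom ⊥ cs

-- Write u = x ∨ bᵢ and z = u ∨ bᵢ₊₁ for the two steps of the chain that change.
-- Semimodularity of the rank and rank 1 of atoms give the covering property
-- x ⋖ x ∨ e for every atom e ≰ x, so x ⋖ x ∨ bᵢ₊₁ ⋖ z; and bᵢ₊₁ is the least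
-- label of the first step since any atom e with x ∨ e = x ∨ bᵢ₊₁ also has
-- u ∨ e = z. If an atom e ⊏ bᵢ had (x ∨ bᵢ₊₁) ∨ e = z, then e ≤ z and the
-- covers x ⋖ u ⋖ z would make e a label of one of them, against minimality of
-- bᵢ or bᵢ₊₁ (as e ⊏ bᵢ ⊏ bᵢ₊₁), or put e below x, where it cannot raise
-- x ∨ bᵢ₊₁. All case distinctions are decidable because L is atomic: an atom
-- is either below y or meets y in 0̂.

module Submission where

open import Defs
open import Level using (Level; _⊔_)
open import Data.Nat using (ℕ; suc)
open import Data.List using (List; _∷_; _++_)
open import Relation.Binary using (Rel)
open import Relation.Binary.Lattice.Bundles using (BoundedLattice)

import Data.Nat as ℕ
import Data.Nat.Properties as ℕ
open import Data.Nat.Induction using (<-wellFounded)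
open import Data.List using ([])
open import Data.List.Properties using (length-++)
open import Data.List.Relation.Unary.All as All using (All; []; _∷_)
open import Data.Product using (∃; _×_; _,_; proj₁; proj₂; uncurry)
open import Data.Sum as Sum using (_⊎_; inj₁; inj₂)
open import Data.Unit.Polymorphic using (tt)
open import Function using (_∘_; _on_)
open import Induction.WellFounded using (Acc; acc)
open import Relation.Nullary using (¬_; Dec; yes; no; contradiction)
open import Relation.Nullary.Decidable using (map′; _×-dec_)
open import Relation.Binary using (Decidable; Tri; tri<; tri≈; tri>)
open import Relation.Binary.PropositionalEquality as ≡ using (_≡_)
import Relation.Binary.Construct.NonStrictToStrict as NonStrictToStrict
import Relation.Binary.Construct.On as On
import Relation.Binary.Lattice.Properties.JoinSemilattice as JoinSemilatticeProperties
import Relation.Binary.Properties.Poset as PosetProperties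
import Relation.Binary.Reasoning.Setoid as SetoidReasoning

module _ {c ℓ₁ ℓ₂ : Level} (L : BoundedLattice c ℓ₁ ℓ₂) where
  open BoundedLattice L
  open LatticeNotions L
  open JoinSemilatticeProperties joinSemilattice using (∨-cong; ∨-assoc; ∨-comm; x≤y⇒x∨y≈y)
  open NonStrictToStrict _≈_ _≤_ using (<-decidable; <-trans)

  x∨y≈x⇒y≤x : ∀ {x y} → x ∨ y ≈ x → y ≤ x
  x∨y≈x⇒y≤x x∨y≈x = trans (y≤x∨y _ _) (reflexive x∨y≈x)

  y≤x⇒x∨y≈x : ∀ {x y} → y ≤ x → x ∨ y ≈ x
  y≤x⇒x∨y≈x y≤x = Eq.trans (∨-comm _ _) (x≤y⇒x∨y≈y y≤x)

  [x∨y]∨z≈[x∨z]∨y : ∀ x y z → (x ∨ y) ∨ z ≈ (x ∨ z) ∨ y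
  [x∨y]∨z≈[x∨z]∨y x y z = begin
    (x ∨ y) ∨ z  ≈⟨ ∨-assoc x y z ⟩
    x ∨ (y ∨ z)  ≈⟨ ∨-cong Eq.refl (∨-comm y z) ⟩
    x ∨ (z ∨ y)  ≈⟨ ∨-assoc x z y ⟨
    (x ∨ z) ∨ y  ∎
    where open SetoidReasoning setoid

  x≤u⇒x∨e≈x∨b⇒u∨e≈u∨b : ∀ {x u e b} → x ≤ u → x ∨ e ≈ x ∨ b → u ∨ e ≈ u ∨ b
  x≤u⇒x∨e≈x∨b⇒u∨e≈u∨b {x} {u} {e} {b} x≤u x∨e≈x∨b = begin
    u ∨ e        ≈⟨ ∨-cong (Eq.sym u∨x≈u) Eq.refl ⟩
    (u ∨ x) ∨ e  ≈⟨ ∨-assoc u x e ⟩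
    u ∨ (x ∨ e)  ≈⟨ ∨-cong Eq.refl x∨e≈x∨b ⟩
    u ∨ (x ∨ b)  ≈⟨ ∨-assoc u x b ⟨
    (u ∨ x) ∨ b  ≈⟨ ∨-cong u∨x≈u Eq.refl ⟩
    u ∨ b        ∎
    where
    open SetoidReasoning setoid
    u∨x≈u : u ∨ x ≈ u
    u∨x≈u = y≤x⇒x∨y≈x x≤u

  ⋖⇒≉ : ∀ {x y} → x ⋖ y → ¬ (x ≈ y)
  ⋖⇒≉ = proj₂ ∘ proj₁

  ⋖-cong : ∀ {x x' y y'} → x ≈ x' → y ≈ y' → x ⋖ y → x' ⋖ y'
  ⋖-cong x≈x' y≈y' ((x≤y , x≉y) , between) =
    (trans (reflexive (Eq.sym x≈x')) (trans x≤y (reflexive y≈y')) ,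
     λ x'≈y' → x≉y (Eq.trans x≈x' (Eq.trans x'≈y' (Eq.sym y≈y')))) ,
    λ z x'≤z z≤y' → Sum.map (λ z≈x → Eq.trans z≈x x≈x') (λ z≈y → Eq.trans z≈y y≈y')
      (between z (trans (reflexive x≈x') x'≤z) (trans z≤y' (reflexive (Eq.sym y≈y'))))

  ⋖-join-dichotomy : ∀ {x y e} → x ⋖ y → e ≤ y → x ∨ e ≈ x ⊎ x ∨ e ≈ y
  ⋖-join-dichotomy ((x≤y , _) , between) e≤y = between _ (x≤x∨y _ _) (∨-least x≤y e≤y)

  x⋖x∨e⇒e≰x : ∀ {x e} → x ⋖ (x ∨ e) → ¬ (e ≤ x)
  x⋖x∨e⇒e≰x x⋖x∨e e≤x = ⋖⇒≉ x⋖x∨e (Eq.sym (y≤x⇒x∨y≈x e≤x))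

  CoveringProperty : Set (c ⊔ ℓ₁ ⊔ ℓ₂)
  CoveringProperty = ∀ {x a} → IsAtom a → ¬ (a ≤ x) → x ⋖ (x ∨ a)

  atom≤⊎∧≈⊥ : ∀ {a} → IsAtom a → ∀ y → a ≤ y ⊎ y ∧ a ≈ ⊥
  atom≤⊎∧≈⊥ {a} (_ , between) y with between (y ∧ a) (minimum _) (x∧y≤y y a)
  ... | inj₁ y∧a≈⊥ = inj₂ y∧a≈⊥
  ... | inj₂ y∧a≈a = inj₁ (trans (reflexive (Eq.sym y∧a≈a)) (x∧y≤x _ _))

  atom-≤? : ∀ {a} → IsAtom a → ∀ y → Dec (a ≤ y)
  atom-≤? {a} atom y with atom≤⊎∧≈⊥ atom y
  ... | inj₁ a≤y = yes a≤y
  ... | inj₂ y∧a≈⊥ = no λ a≤y →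
    ⋖⇒≉ atom (antisym (minimum a) (trans (∧-greatest a≤y refl) (reflexive y∧a≈⊥)))

  ⋁-atoms-≤? : ∀ {as} → All IsAtom as → ∀ y → Dec (⋁ as ≤ y)
  ⋁-atoms-≤? [] y = yes (minimum y)
  ⋁-atoms-≤? (atom ∷ atoms) y =
    map′ (uncurry ∨-least) (λ ⋁≤y → trans (x≤x∨y _ _) ⋁≤y , trans (y≤x∨y _ _) ⋁≤y)
      (atom-≤? atom y ×-dec ⋁-atoms-≤? atoms y)

  atomic⇒≤-dec : IsAtomic → Decidable _≤_
  atomic⇒≤-dec atomic x y with atomic x
  ... | as , atoms , x≈⋁as =
    map′ (trans (reflexive x≈⋁as)) (trans (reflexive (Eq.sym x≈⋁as))) (⋁-atoms-≤? atoms y)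

  module _ (_≤?_ : Decidable _≤_) where
    _≟_ : Decidable _≈_
    _≟_ = PosetProperties.≤-dec⇒≈-dec poset _≤?_

    _<?_ : Decidable _<_
    _<?_ = <-decidable _≟_ _≤?_

    maximal-above : ∀ {p} {P : Carrier → Set p} → (∀ x → Dec (P x)) →
      ∀ xs {m} → P m → ∃ λ m' → P m' × m ≤ m' × All (λ e → P e → ¬ (m' < e)) xs
    maximal-above P? [] {m} Pm = m , Pm , refl , []
    maximal-above P? (e ∷ xs) Pm with maximal-above P? xs Pm
    ... | m' , Pm' , m≤m' , maximal with P? e | m' <? e
    ...   | yes Pe | yes m'<e = e , Pe , trans m≤m' (proj₁ m'<e) ,
            (λ _ e<e → proj₂ e<e Eq.refl) ∷
            All.map (λ m'≮e' Pe' e<e' → m'≮e' Pe' (<-trans isPartialOrder m'<e e<e')) maximal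
    ...   | yes _  | no m'≮e = m' , Pm' , m≤m' , (λ _ → m'≮e) ∷ maximal
    ...   | no ¬Pe | _       = m' , Pm' , m≤m' , (λ Pe → contradiction Pe ¬Pe) ∷ maximal

    <⇒∃⋖ : IsFinite → ∀ {x y} → x < y → ∃ λ w → x ≤ w × w ⋖ y
    <⇒∃⋖ (elements , enumerates) {x} {y} x<y
      with maximal-above (λ w → (x ≤? w) ×-dec (w <? y)) elements (refl , x<y)
    ... | w , (x≤w , w<y) , _ , maximal = w , x≤w , w<y , between
      where
      between : ∀ z → w ≤ z → z ≤ y → z ≈ w ⊎ z ≈ y
      between z w≤z z≤y with z ≟ w | z ≟ y
      ... | yes z≈w | _       = inj₁ z≈w
      ... | no _    | yes z≈y = inj₂ z≈y
      ... | no z≉w  | no z≉y  with All.lookupAny maximal (enumerates z)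
      ...   | w≮e , z≈e = contradiction
                (trans w≤z (reflexive z≈e) , λ w≈e → z≉w (Eq.trans z≈e (Eq.sym w≈e)))
                (w≮e (trans x≤w (trans w≤z (reflexive z≈e)) ,
                      trans (reflexive (Eq.sym z≈e)) z≤y , λ e≈y → z≉y (Eq.trans z≈e e≈y)))

    module _ (finite : IsFinite) {ρ : Carrier → ℕ} (rank : IsRankFunction ρ) where
      private
        ρ⊥≡0 : ρ ⊥ ≡ 0
        ρ⊥≡0 = proj₁ rank

        ρ-cong : ∀ {x y} → x ≈ y → ρ x ≡ ρ y
        ρ-cong = proj₁ (proj₂ rank)

        ρ-cover : ∀ {x y} → x ⋖ y → ρ y ≡ suc (ρ x)
        ρ-cover = proj₂ (proj₂ rank)

      ⋖⇒ρ< : ∀ {x y} → x ⋖ y → ρ x ℕ.< ρ y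
      ⋖⇒ρ< x⋖y = ℕ.≤-reflexive (≡.sym (ρ-cover x⋖y))

      ρ-strictMono : ∀ {x y} → x < y → ρ x ℕ.< ρ y
      ρ-strictMono {x} {y} = go (On.wellFounded ρ <-wellFounded y)
        where
        go : ∀ {y} → Acc (ℕ._<_ on ρ) y → x < y → ρ x ℕ.< ρ y
        go (acc below) x<y with <⇒∃⋖ finite x<y
        ... | w , x≤w , w⋖y with x ≟ w
        ...   | yes x≈w = ℕ.≤-<-trans (ℕ.≤-reflexive (ρ-cong x≈w)) (⋖⇒ρ< w⋖y)
        ...   | no x≉w  = ℕ.<-trans (go (below (⋖⇒ρ< w⋖y)) (x≤w , x≉w)) (⋖⇒ρ< w⋖y)

      ρ-atom : ∀ {a} → IsAtom a → ρ a ≡ 1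
      ρ-atom atom = ≡.trans (ρ-cover atom) (≡.cong suc ρ⊥≡0)

      ρ-join-atom : IsSemimodularRank ρ → ∀ x {a} → IsAtom a → ρ (x ∨ a) ℕ.≤ suc (ρ x)
      ρ-join-atom semimodular x {a} atom = ℕ.m+n≤o⇒m≤o (ρ (x ∨ a))
        (≡.subst (ρ (x ∨ a) ℕ.+ ρ (x ∧ a) ℕ.≤_)
          (≡.trans (≡.cong (ρ x ℕ.+_) (ρ-atom atom)) (ℕ.+-comm (ρ x) 1))
          (semimodular x a))

      semimodular⇒covering : IsSemimodularRank ρ → CoveringProperty
      semimodular⇒covering semimodular {x} {a} atom a≰x =
        (x≤x∨y x a , λ x≈x∨a → a≰x (trans (y≤x∨y x a) (reflexive (Eq.sym x≈x∨a)))) , between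
        where
        between : ∀ z → x ≤ z → z ≤ x ∨ a → z ≈ x ⊎ z ≈ x ∨ a
        between z x≤z z≤x∨a with z ≟ x | z ≟ (x ∨ a)
        ... | yes z≈x | _         = inj₁ z≈x
        ... | no _    | yes z≈x∨a = inj₂ z≈x∨a
        ... | no z≉x  | no z≉x∨a  = contradiction (ρ-strictMono (x≤z , z≉x ∘ Eq.sym)) (ℕ.≤⇒≯
          (ℕ.m<1+n⇒m≤n (ℕ.<-≤-trans (ρ-strictMono (z≤x∨a , z≉x∨a)) (ρ-join-atom semimodular x atom))))

  module _ {ℓ} {_⊏_ : Rel Carrier ℓ} (linear : IsLinearOrderOnAtoms _⊏_) where
    private
      ⊏-trans : ∀ {a b d} → IsAtom a → IsAtom b → IsAtom d → a ⊏ b → b ⊏ d → a ⊏ d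
      ⊏-trans = proj₁ (proj₂ linear)

      ⊏-compare : ∀ a b → IsAtom a → IsAtom b → Tri (a ⊏ b) (a ≈ b) (b ⊏ a)
      ⊏-compare = proj₂ (proj₂ linear)

    ⊏⇒¬≈⊎⊏ : ∀ {p q} → IsAtom p → IsAtom q → q ⊏ p → ¬ (p ≈ q ⊎ p ⊏ q)
    ⊏⇒¬≈⊎⊏ {p} {q} atomP atomQ q⊏p p≈q⊎p⊏q with ⊏-compare p q atomP atomQ | p≈q⊎p⊏q
    ... | tri< _ _ q⊀p | _        = q⊀p q⊏p
    ... | tri≈ _ _ q⊀p | _        = q⊀p q⊏p
    ... | tri> _ p≉q _ | inj₁ p≈q = p≉q p≈q
    ... | tri> p⊀q _ _ | inj₂ p⊏q = p⊀q p⊏q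

    IsMinLabel-cong : ∀ {x x' y y' e} → x ≈ x' → y ≈ y' → IsMinLabel _⊏_ x y e → IsMinLabel _⊏_ x' y' e
    IsMinLabel-cong x≈x' y≈y' (atom , x∨e≈y , least) =
      atom ,
      Eq.trans (∨-cong (Eq.sym x≈x') Eq.refl) (Eq.trans x∨e≈y y≈y') ,
      λ e' atom' x'∨e'≈y' → least e' atom' (Eq.trans (∨-cong x≈x' Eq.refl) (Eq.trans x'∨e'≈y' (Eq.sym y≈y')))

    MinLabFrom-cong : ∀ cs {x x'} → x ≈ x' → MinLabFrom _⊏_ x cs → MinLabFrom _⊏_ x' cs
    MinLabFrom-cong [] x≈x' (x≈⊤ , tt) = Eq.trans (Eq.sym x≈x') x≈⊤ , tt
    MinLabFrom-cong (e ∷ cs) {x} {x'} x≈x' (cover , minLabel , rest) =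
      ⋖-cong x≈x' x∨e≈x'∨e cover ,
      IsMinLabel-cong x≈x' x∨e≈x'∨e minLabel ,
      MinLabFrom-cong cs x∨e≈x'∨e rest
      where
      x∨e≈x'∨e : x ∨ e ≈ x' ∨ e
      x∨e≈x'∨e = ∨-cong x≈x' Eq.refl

    module AdjacentSwap (covering : CoveringProperty) {x a b : Carrier}
      (x⋖x∨a : x ⋖ (x ∨ a)) (a-minLabel : IsMinLabel _⊏_ x (x ∨ a) a)
      (x∨a⋖x∨a∨b : (x ∨ a) ⋖ ((x ∨ a) ∨ b)) (b-minLabel : IsMinLabel _⊏_ (x ∨ a) ((x ∨ a) ∨ b) b)
      (a⊏b : a ⊏ b) where
      private
        atomA : IsAtom a
        atomA = proj₁ a-minLabel

        atomB : IsAtom b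
        atomB = proj₁ b-minLabel

      x⋖x∨b : x ⋖ (x ∨ b)
      x⋖x∨b = covering atomB λ b≤x → x⋖x∨e⇒e≰x x∨a⋖x∨a∨b (trans b≤x (x≤x∨y x a))

      b-minLabel′ : IsMinLabel _⊏_ x (x ∨ b) b
      b-minLabel′ = atomB , Eq.refl , λ e atomE x∨e≈x∨b →
        proj₂ (proj₂ b-minLabel) e atomE (x≤u⇒x∨e≈x∨b⇒u∨e≈u∨b (x≤x∨y x a) x∨e≈x∨b)

      a≰x∨b : ¬ (a ≤ x ∨ b)
      a≰x∨b a≤x∨b with ⋖-join-dichotomy x⋖x∨b a≤x∨b
      ... | inj₁ x∨a≈x   = ⋖⇒≉ x⋖x∨a (Eq.sym x∨a≈x)
      ... | inj₂ x∨a≈x∨b = ⋖⇒≉ x∨a⋖x∨a∨b (Eq.trans x∨a≈x∨b (Eq.sym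
              (Eq.trans (∨-cong x∨a≈x∨b Eq.refl) (y≤x⇒x∨y≈x (y≤x∨y x b)))))

      x∨b⋖x∨b∨a : (x ∨ b) ⋖ ((x ∨ b) ∨ a)
      x∨b⋖x∨b∨a = covering atomA a≰x∨b

      x∨b∨a≈x∨a∨b : (x ∨ b) ∨ a ≈ (x ∨ a) ∨ b
      x∨b∨a≈x∨a∨b = [x∨y]∨z≈[x∨z]∨y x b a

      a-minLabel′ : IsMinLabel _⊏_ (x ∨ b) ((x ∨ b) ∨ a) a
      a-minLabel′ = atomA , Eq.refl , least
        where
        least : ∀ e → IsAtom e → (x ∨ b) ∨ e ≈ (x ∨ b) ∨ a → a ≈ e ⊎ a ⊏ e
        least e atomE x∨b∨e≈x∨b∨a with ⊏-compare a e atomA atomE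
        ... | tri< a⊏e _ _ = inj₂ a⊏e
        ... | tri≈ _ a≈e _ = inj₁ a≈e
        ... | tri> _ _ e⊏a with ⋖-join-dichotomy x∨a⋖x∨a∨b
                                  (trans (y≤x∨y _ e) (reflexive (Eq.trans x∨b∨e≈x∨b∨a x∨b∨a≈x∨a∨b)))
        ...   | inj₂ x∨a∨e≈x∨a∨b = contradiction (proj₂ (proj₂ b-minLabel) e atomE x∨a∨e≈x∨a∨b)
                  (⊏⇒¬≈⊎⊏ atomB atomE (⊏-trans atomE atomA atomB e⊏a a⊏b))
        ...   | inj₁ x∨a∨e≈x∨a with ⋖-join-dichotomy x⋖x∨a (x∨y≈x⇒y≤x x∨a∨e≈x∨a)
        ...     | inj₂ x∨e≈x∨a = contradiction (proj₂ (proj₂ a-minLabel) e atomE x∨e≈x∨a)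
                  (⊏⇒¬≈⊎⊏ atomA atomE e⊏a)
        ...     | inj₁ x∨e≈x   = contradiction a≤x∨b a≰x∨b
          where
          a≤x∨b : a ≤ x ∨ b
          a≤x∨b = x∨y≈x⇒y≤x (Eq.trans (Eq.sym x∨b∨e≈x∨b∨a)
                    (y≤x⇒x∨y≈x (trans (x∨y≈x⇒y≤x x∨e≈x) (x≤x∨y x b))))

    MinLabFrom-swap : CoveringProperty → ∀ {x a b} post →
      MinLabFrom _⊏_ x (a ∷ b ∷ post) → a ⊏ b → MinLabFrom _⊏_ x (b ∷ a ∷ post)
    MinLabFrom-swap covering post (x⋖x∨a , a-minLabel , x∨a⋖x∨a∨b , b-minLabel , rest) a⊏b =
      x⋖x∨b , b-minLabel′ , x∨b⋖x∨b∨a , a-minLabel′ , MinLabFrom-cong post (Eq.sym x∨b∨a≈x∨a∨b) rest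
      where open AdjacentSwap covering x⋖x∨a a-minLabel x∨a⋖x∨a∨b b-minLabel a⊏b

    MinLabFrom-swap-++ : CoveringProperty → ∀ pre {x a b} post →
      MinLabFrom _⊏_ x (pre ++ a ∷ b ∷ post) → a ⊏ b → MinLabFrom _⊏_ x (pre ++ b ∷ a ∷ post)
    MinLabFrom-swap-++ covering [] post = MinLabFrom-swap covering post
    MinLabFrom-swap-++ covering (e ∷ pre) post (cover , minLabel , rest) a⊏b =
      cover , minLabel , MinLabFrom-swap-++ covering pre post rest a⊏b

lemma4p3 : {c ℓ₁ ℓ₂ ℓ : Level} (L : BoundedLattice c ℓ₁ ℓ₂) (r : ℕ) (ρ : BoundedLattice.Carrier L → ℕ)
    → LatticeNotions.IsGeometricOfRank L (suc r) ρ
    → (_⊏_ : Rel (BoundedLattice.Carrier L) ℓ) → LatticeNotions.IsLinearOrderOnAtoms L _⊏_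
    → (pre : List (BoundedLattice.Carrier L)) (bᵢ bᵢ₊₁ : BoundedLattice.Carrier L) (post : List (BoundedLattice.Carrier L))
    → LatticeNotions.IsMinLabelingOfFacet L _⊏_ r (pre ++ bᵢ ∷ bᵢ₊₁ ∷ post)
    → bᵢ ⊏ bᵢ₊₁
    → LatticeNotions.IsMinLabelingOfFacet L _⊏_ r (pre ++ bᵢ₊₁ ∷ bᵢ ∷ post)
lemma4p3 L r ρ (finite , atomic , rank , semimodular , _) _⊏_ linear pre bᵢ bᵢ₊₁ post (length≡ , minLabels) bᵢ⊏bᵢ₊₁ =
  ≡.trans (length-++ pre) (≡.trans (≡.sym (length-++ pre)) length≡) ,
  MinLabFrom-swap-++ L linear covering pre post minLabels bᵢ⊏bᵢ₊₁
  where
  covering : CoveringProperty L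
  covering = semimodular⇒covering L (atomic⇒≤-dec L atomic) finite rank semimodular
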